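{- Let $k \ge 2$ be an integer, and let $\mathcal{G}$ be a hereditary class of finite simple graphs such that every graph $G\in\mathcal{G}$ contains a $k$-simplicial vertex. Then every graph in $\mathcal{G}$ (with at least one edge) is $(k+1)$-divisible.
   Context: A class of graphs is hereditary if it is closed under taking induced subgraphs. A vertex $v$ of a graph $G$ is $k$-simplicial if its neighborhood $N_G(v)$ can be partitioned into $k$ (possibly empty) cliques. $\omega(H)$ denotes the clique number of $H$; a maximum clique of $H$ is a clique of size $\omega(H)$. For an integer $m\ge 2$, a graph $G$ with at least one edge is $m$-divisible if for every induced subgraph $H$ of $G$ with at least one edge, the vertex set $V(H)$ can be partitioned into $m$ sets, none of which contains a maximum clique of $H$. -}

module Defs where

open import Data.Nat using (ℕ; _≤_)
open import Data.Bool using (Bool; true; false)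
open import Data.Fin using (Fin)
open import Data.Fin.Subset using (Subset; _∈_; ∣_∣)
open import Data.Product using (Σ; ∃; ∃-syntax; _×_)
open import Relation.Binary.PropositionalEquality using (_≡_; _≢_)
open import Relation.Nullary using (¬_)
open import Function.Definitions using (Injective)

record Graph : Set where
  field
    n      : ℕ
    adj    : Fin n → Fin n → Bool
    sym    : ∀ x y → adj x y ≡ adj y x
    irrefl : ∀ x → adj x x ≡ false

open Graph public

-- H is (isomorphic to) an induced subgraph of G: an injective map
-- V(H) → V(G) preserving adjacency and non-adjacency.
record InducedSubgraph (H G : Graph) : Set where
  field
    emb     : Fin (n H) → Fin (n G)
    inj     : Injective _≡_ _≡_ emb
    adj-pres : ∀ x y → adj H x y ≡ adj G (emb x) (emb y)

Hereditary : (Graph → Set) → Set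
Hereditary 𝒢 = ∀ G H → 𝒢 G → InducedSubgraph H G → 𝒢 H

HasEdge : Graph → Set
HasEdge G = ∃[ x ] ∃[ y ] adj G x y ≡ true

Adjacent : (G : Graph) → Fin (n G) → Fin (n G) → Set
Adjacent G x y = adj G x y ≡ true

IsClique : (G : Graph) → Subset (n G) → Set
IsClique G S = ∀ x y → x ∈ S → y ∈ S → x ≢ y → Adjacent G x y

IsMaxClique : (G : Graph) → Subset (n G) → Set
IsMaxClique G S = IsClique G S × (∀ T → IsClique G T → ∣ T ∣ ≤ ∣ S ∣)

-- v is k-simplicial: N(v) can be partitioned into k (possibly empty)
-- cliques; the partition is given by a labelling c of N(v) by Fin k
-- (we label all vertices; only labels of neighbours of v matter).
KSimplicial : (k : ℕ) (G : Graph) → Fin (n G) → Set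
KSimplicial k G v =
  Σ (Fin (n G) → Fin k) λ c →
    ∀ x y → Adjacent G v x → Adjacent G v y → c x ≡ c y → x ≢ y → Adjacent G x y

GoodPartition : (m : ℕ) (H : Graph) → Set
GoodPartition m H =
  Σ (Fin (n H) → Fin m) λ p →
    ∀ (S : Subset (n H)) → IsMaxClique H S → ∀ (i : Fin m) →
      ¬ (∀ x → x ∈ S → p x ≡ i)

Divisible : (m : ℕ) → Graph → Set
Divisible m G =
  HasEdge G ×
  (∀ H → InducedSubgraph H G → HasEdge H → GoodPartition m H)

{-# OPTIONS --safe #-}
-- Fix a k-simplicial vertex v of G with its k neighbourhood cliques. If every clique
-- of G has at most c + 2 vertices, each neighbourhood clique has at most c + 1, so v
-- has at most k(c + 1) neighbours. Colour G - v with k + 1 colours by induction so that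
-- no monochromatic clique has c + 2 vertices; by pigeonhole some colour occurs on at
-- most c neighbours of v, and giving v that colour keeps the property. Taking
-- c + 2 = ω(H) for a graph H with an edge yields the partition.
module Submission where

open import Defs hiding (sym)
open import Data.Bool using (Bool; true; false)
open import Data.Bool.Properties using () renaming (_≟_ to _≟ᵇ_)
open import Data.Fin using (Fin; zero; suc; punchIn; punchOut)
open import Data.Fin.Properties
  using (any?; all?; punchIn-injective; punchInᵢ≢i; punchIn-punchOut)
  renaming (_≟_ to _≟ᶠ_)
open import Data.Fin.Subset
  using (Subset; inside; outside; _∈_; _⊆_; _∩_; _∪_; ⁅_⁆; ⊥; ∣_∣)
open import Data.Fin.Subset.Properties
  using (_∈?_; ∉⊥; ∣⊥∣≡0; ∣p∣≤n; ∣⁅x⁆∣≡1; x∈⁅x⁆; x∈⁅y⁆⇒x≡y; x∈p∩q⁺; x∈p∩q⁻;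
         p⊆p∪q; x∈p∪q⁺; x∈p∪q⁻; p⊆q⇒∣p∣≤∣q∣; p⊂q⇒∣p∣<∣q∣; anySubset?)
open import Data.Nat using (ℕ; zero; suc; _+_; _*_; _≤_; _<_; z≤n; s≤s; _≤?_)
open import Data.Nat.Properties
  using (+-0-commutativeMonoid; +-comm; +-suc; +-mono-≤; m≤n+m; ≤-pred; ≤-trans;
         ≤∧≢⇒<; <⇒≱; ≰⇒>; n≤0⇒n≡0; module ≤-Reasoning)
  renaming (_≟_ to _≟ℕ_)
open import Data.Product using (∃; ∃-syntax; _×_; _,_; proj₁)
open import Data.Sum as Sum using (_⊎_; inj₁; inj₂)
open import Data.Vec using (_∷_; []; lookup; tabulate; insertAt; removeAt)
open import Data.Vec.Properties
  using (lookup⇒[]=; []=⇒lookup; lookup∘tabulate; insertAt-lookup; insertAt-punchIn; insertAt-removeAt)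
import Data.Vec.Functional as Vector
import Data.Vec.Functional.Properties as Vectorₚ
open import Function using (_∘_; Injective)
open import Relation.Binary.PropositionalEquality using (_≡_; _≢_; refl; sym; trans; cong; subst)
open import Relation.Nullary using (Dec; yes; no; does; contradiction)
open import Relation.Nullary.Decidable using (dec-true; _×-dec_; _→-dec_; ¬?)
open import Relation.Unary using (Pred; Decidable)
open import Algebra.Properties.CommutativeMonoid.Sum +-0-commutativeMonoid
  using (sum; sum-syntax; sum-replicate-zero)

∑-const : ∀ n c → ∑[ i < n ] c ≡ n * c
∑-const zero    c = refl
∑-const (suc n) c = cong (c +_) (∑-const n c)

∑-mono-≤ : ∀ {n} {f g : Fin n → ℕ} → (∀ i → f i ≤ g i) → sum f ≤ sum g
∑-mono-≤ {zero}  f≤g = z≤n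
∑-mono-≤ {suc n} f≤g = +-mono-≤ (f≤g zero) (∑-mono-≤ (f≤g ∘ suc))

pigeonhole : ∀ {k} c (A : Fin (suc k) → ℕ) → sum A ≤ k * suc c → ∃ λ j → A j ≤ c
pigeonhole {k} c A ∑A≤ with any? (λ j → A j ≤? c)
... | yes small = small
... | no ¬small = contradiction ∑A≤ (<⇒≱ (begin-strict
  k * suc c             <⟨ s≤s (m≤n+m (k * suc c) c) ⟩
  suc k * suc c         ≡⟨ sym (∑-const (suc k) (suc c)) ⟩
  ∑[ j < suc k ] suc c  ≤⟨ ∑-mono-≤ (λ j → ≰⇒> (¬small ∘ (j ,_))) ⟩
  sum A                 ∎))
  where open ≤-Reasoning

∈tabulate⁺ : ∀ {m} {f : Fin m → Bool} {x} → f x ≡ inside → x ∈ tabulate f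
∈tabulate⁺ {f = f} {x} fx = lookup⇒[]= x (tabulate f) (trans (lookup∘tabulate f x) fx)

∈tabulate⁻ : ∀ {m} {f : Fin m → Bool} {x} → x ∈ tabulate f → f x ≡ inside
∈tabulate⁻ {f = f} {x} x∈ = trans (sym (lookup∘tabulate f x)) ([]=⇒lookup x∈)

fibre : ∀ {m r} → (Fin m → Fin r) → Fin r → Subset m
fibre f j = tabulate (λ x → does (f x ≟ᶠ j))

∈fibre⁺ : ∀ {m r} (f : Fin m → Fin r) {j x} → f x ≡ j → x ∈ fibre f j
∈fibre⁺ f {j} {x} fx≡j = ∈tabulate⁺ (dec-true (f x ≟ᶠ j) fx≡j)

∈fibre⁻ : ∀ {m r} (f : Fin m → Fin r) {j x} → x ∈ fibre f j → f x ≡ j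
∈fibre⁻ f {j} {x} x∈ with f x ≟ᶠ j | ∈tabulate⁻ {f = λ y → does (f y ≟ᶠ j)} x∈
... | yes fx≡j | _ = fx≡j

∑∣[i≟j]∷qⱼ∣ : ∀ {m r} (i : Fin r) (q : Fin r → Subset m) →
              ∑[ j < r ] ∣ does (i ≟ᶠ j) ∷ q j ∣ ≡ suc (∑[ j < r ] ∣ q j ∣)
∑∣[i≟j]∷qⱼ∣ zero    q = refl
∑∣[i≟j]∷qⱼ∣ (suc i) q = trans (cong (∣ q zero ∣ +_) (∑∣[i≟j]∷qⱼ∣ i (q ∘ suc))) (+-suc ∣ q zero ∣ _)

∣p∣≡∑∣p∩fibre∣ : ∀ {m r} (f : Fin m → Fin r) (p : Subset m) → ∣ p ∣ ≡ ∑[ j < r ] ∣ p ∩ fibre f j ∣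
∣p∣≡∑∣p∩fibre∣ {r = r} f []            = sym (sum-replicate-zero r)
∣p∣≡∑∣p∩fibre∣         f (outside ∷ p) = ∣p∣≡∑∣p∩fibre∣ (f ∘ suc) p
∣p∣≡∑∣p∩fibre∣         f (inside  ∷ p) =
  trans (cong suc (∣p∣≡∑∣p∩fibre∣ (f ∘ suc) p)) (sym (∑∣[i≟j]∷qⱼ∣ (f zero) (λ j → p ∩ fibre (f ∘ suc) j)))

data PunchInView {m} (v : Fin (suc m)) : Fin (suc m) → Set where
  pivot   : PunchInView v v
  punched : ∀ x → PunchInView v (punchIn v x)

punchInView : ∀ {m} (v x : Fin (suc m)) → PunchInView v x
punchInView v x with v ≟ᶠ x
... | yes refl = pivot
... | no v≢x   = subst (PunchInView v) (punchIn-punchOut v≢x) (punched (punchOut v≢x))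

∣insertAt∣ : ∀ {m} (p : Subset m) v s → ∣ insertAt p v s ∣ ≡ ∣ s ∷ p ∣
∣insertAt∣ p             zero    s       = refl
∣insertAt∣ (outside ∷ p) (suc v) s       = ∣insertAt∣ p v s
∣insertAt∣ (inside  ∷ p) (suc v) outside = cong suc (∣insertAt∣ p v outside)
∣insertAt∣ (inside  ∷ p) (suc v) inside  = cong suc (∣insertAt∣ p v inside)

module _ {m} {p : Subset m} {v : Fin (suc m)} where

  punchIn∈insertAt⁺ : ∀ {x s} → x ∈ p → punchIn v x ∈ insertAt p v s
  punchIn∈insertAt⁺ {x} {s} x∈p =
    lookup⇒[]= (punchIn v x) _ (trans (insertAt-punchIn p v s x) ([]=⇒lookup x∈p))

  punchIn∈insertAt⁻ : ∀ {x s} → punchIn v x ∈ insertAt p v s → x ∈ p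
  punchIn∈insertAt⁻ {x} {s} x∈ = lookup⇒[]= x p (trans (sym (insertAt-punchIn p v s x)) ([]=⇒lookup x∈))

  v∈insertAt⁺ : v ∈ insertAt p v inside
  v∈insertAt⁺ = lookup⇒[]= v _ (insertAt-lookup p v inside)

  v∈insertAt⁻ : ∀ {s} → v ∈ insertAt p v s → s ≡ inside
  v∈insertAt⁻ {s} v∈ = trans (sym (insertAt-lookup p v s)) ([]=⇒lookup v∈)

CliquesAtMost : Graph → ℕ → Set
CliquesAtMost G b = ∀ S → IsClique G S → ∣ S ∣ ≤ b

Monochromatic : ∀ {m r} → (Fin m → Fin r) → Fin r → Subset m → Set
Monochromatic p i S = ∀ x → x ∈ S → p x ≡ i

MonochromaticCliquesBelow : ∀ {r} (G : Graph) → (Fin (n G) → Fin r) → ℕ → Set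
MonochromaticCliquesBelow G p b = ∀ S i → IsClique G S → Monochromatic p i S → ∣ S ∣ < b

insertAt-monochromatic⁻ : ∀ {m r} {p : Fin m → Fin r} {v c i S s} →
  Monochromatic (Vector.insertAt p v c) i (insertAt S v s) → Monochromatic p i S
insertAt-monochromatic⁻ {p = p} {v} {c} mono x x∈S =
  trans (sym (Vectorₚ.insertAt-punchIn p v c x)) (mono (punchIn v x) (punchIn∈insertAt⁺ x∈S))

induced : (G : Graph) {m : ℕ} → (Fin m → Fin (n G)) → Graph
induced G {m} e = record
  { n      = m
  ; adj    = λ x y → adj G (e x) (e y)
  ; sym    = λ x y → Graph.sym G (e x) (e y)
  ; irrefl = λ x → irrefl G (e x)
  }

induced-isInducedSubgraph : ∀ G {m} (e : Fin m → Fin (n G)) → Injective _≡_ _≡_ e →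
                            InducedSubgraph (induced G e) G
induced-isInducedSubgraph G e e-injective =
  record { emb = e ; inj = e-injective ; adj-pres = λ x y → refl }

-- Parameterised by the fields of G rather than by G, so that the order of G is
-- syntactically suc m.
module Deletion {m} (a : Fin (suc m) → Fin (suc m) → Bool) (a-sym : ∀ x y → a x y ≡ a y x)
                (a-irrefl : ∀ x → a x x ≡ false) (v : Fin (suc m)) where

  G : Graph
  G = record { n = suc m ; adj = a ; sym = a-sym ; irrefl = a-irrefl }

  G-v : Graph
  G-v = induced G (punchIn v)

  neighbours : Subset m
  neighbours = tabulate (λ x → a v (punchIn v x))

  insertAt-clique⁺ : ∀ {C s} → IsClique G-v C → (s ≡ inside → C ⊆ neighbours) → IsClique G (insertAt C v s)
  insertAt-clique⁺ C-clique cone x y x∈ y∈ x≢y with punchInView v x | punchInView v y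
  ... | pivot     | pivot     = contradiction refl x≢y
  ... | pivot     | punched _ = ∈tabulate⁻ (cone (v∈insertAt⁻ x∈) (punchIn∈insertAt⁻ y∈))
  ... | punched _ | pivot     = trans (a-sym _ v) (∈tabulate⁻ (cone (v∈insertAt⁻ y∈) (punchIn∈insertAt⁻ x∈)))
  ... | punched x | punched y =
    C-clique x y (punchIn∈insertAt⁻ x∈) (punchIn∈insertAt⁻ y∈) (x≢y ∘ cong (punchIn v))

  insertAt-clique⁻ : ∀ {C s} → IsClique G (insertAt C v s) → IsClique G-v C
  insertAt-clique⁻ clique x y x∈ y∈ x≢y =
    clique _ _ (punchIn∈insertAt⁺ x∈) (punchIn∈insertAt⁺ y∈) (x≢y ∘ punchIn-injective v x y)

  insertAt-clique⇒⊆neighbours : ∀ {C} → IsClique G (insertAt C v inside) → C ⊆ neighbours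
  insertAt-clique⇒⊆neighbours clique {x} x∈ =
    ∈tabulate⁺ (clique _ _ v∈insertAt⁺ (punchIn∈insertAt⁺ x∈) (punchInᵢ≢i v x ∘ sym))

  cliquesAtMost-G-v : ∀ {b} → CliquesAtMost G b → CliquesAtMost G-v b
  cliquesAtMost-G-v {b} ω≤ C C-clique =
    subst (_≤ b) (∣insertAt∣ C v outside) (ω≤ _ (insertAt-clique⁺ C-clique λ ()))

  ∣neighbours∣≤ : ∀ {k c} → KSimplicial k G v → CliquesAtMost G (2 + c) → ∣ neighbours ∣ ≤ k * suc c
  ∣neighbours∣≤ {k} {c} (col , col-cliques) ω≤ = begin
    ∣ neighbours ∣                ≡⟨ ∣p∣≡∑∣p∩fibre∣ (col ∘ punchIn v) neighbours ⟩
    ∑[ i < k ] ∣ colourClass i ∣  ≤⟨ ∑-mono-≤ colourClass-small ⟩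
    ∑[ i < k ] suc c              ≡⟨ ∑-const k (suc c) ⟩
    k * suc c                     ∎
    where
    open ≤-Reasoning
    colourClass : Fin k → Subset m
    colourClass i = neighbours ∩ fibre (col ∘ punchIn v) i
    colourClass-clique : ∀ i → IsClique G-v (colourClass i)
    colourClass-clique i x y x∈ y∈ x≢y with x∈p∩q⁻ neighbours _ x∈ | x∈p∩q⁻ neighbours _ y∈
    ... | x∈N , x∈i | y∈N , y∈i =
      col-cliques _ _ (∈tabulate⁻ x∈N) (∈tabulate⁻ y∈N)
        (trans (∈fibre⁻ (col ∘ punchIn v) x∈i) (sym (∈fibre⁻ (col ∘ punchIn v) y∈i)))
        (x≢y ∘ punchIn-injective v x y)
    colourClass-small : ∀ i → ∣ colourClass i ∣ ≤ suc c
    colourClass-small i = ≤-pred (subst (_≤ 2 + c) (∣insertAt∣ (colourClass i) v inside)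
      (ω≤ _ (insertAt-clique⁺ (colourClass-clique i) (λ _ → proj₁ ∘ x∈p∩q⁻ neighbours _))))

  extendColouring : ∀ {k b} → KSimplicial k G v → 2 ≤ b → CliquesAtMost G b →
    (∃ λ (p : Fin m → Fin (suc k)) → MonochromaticCliquesBelow G-v p b) →
    ∃ λ (p⁺ : Fin (suc m) → Fin (suc k)) → MonochromaticCliquesBelow G p⁺ b
  extendColouring {k} {suc (suc c)} simplicial (s≤s (s≤s z≤n)) ω≤ (p , p-good)
    with pigeonhole c (λ j → ∣ neighbours ∩ fibre p j ∣)
           (subst (_≤ k * suc c) (∣p∣≡∑∣p∩fibre∣ p neighbours) (∣neighbours∣≤ simplicial ω≤))
  ... | j , rare = p⁺ , λ S i →
    subst (λ S → IsClique G S → Monochromatic p⁺ i S → ∣ S ∣ < 2 + c)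
      (insertAt-removeAt S v) (good (removeAt S v) (lookup S v) i)
    where
    p⁺ : Fin (suc m) → Fin (suc k)
    p⁺ = Vector.insertAt p v j
    good : ∀ S s i → IsClique G (insertAt S v s) → Monochromatic p⁺ i (insertAt S v s) →
           ∣ insertAt S v s ∣ < 2 + c
    good S outside i clique mono = subst (_< 2 + c) (sym (∣insertAt∣ S v outside))
      (p-good S i (insertAt-clique⁻ clique) (insertAt-monochromatic⁻ mono))
    good S inside i clique mono = subst (_< 2 + c) (sym (∣insertAt∣ S v inside))
      (s≤s (s≤s (≤-trans (p⊆q⇒∣p∣≤∣q∣ S⊆) rare)))
      where
      j≡i : j ≡ i
      j≡i = trans (sym (Vectorₚ.insertAt-lookup p v j)) (mono v v∈insertAt⁺)
      S⊆ : S ⊆ neighbours ∩ fibre p j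
      S⊆ {x} x∈ = x∈p∩q⁺ (insertAt-clique⇒⊆neighbours clique x∈ ,
                          ∈fibre⁺ p (trans (insertAt-monochromatic⁻ mono x x∈) (sym j≡i)))

greatest : ∀ {ℓ} {P : Pred ℕ ℓ} → Decidable P → ∀ n → (∀ {b} → P b → b ≤ n) →
           ∀ {a} → P a → ∃ λ b → P b × (∀ {c} → P c → c ≤ b)
greatest {P = P} P? zero    ≤0 Pa = 0 , subst P (n≤0⇒n≡0 (≤0 Pa)) Pa , ≤0
greatest {P = P} P? (suc n) ≤n Pa with P? (suc n)
... | yes Pn = suc n , Pn , ≤n
... | no ¬Pn = greatest P? n (λ Pb → ≤-pred (≤∧≢⇒< (≤n Pb) (λ b≡n → ¬Pn (subst P b≡n Pb)))) Pa

isClique? : ∀ G S → Dec (IsClique G S)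
isClique? G S = all? λ x → all? λ y →
  x ∈? S →-dec (y ∈? S →-dec (¬? (x ≟ᶠ y) →-dec (adj G x y ≟ᵇ true)))

HasCliqueOfSize : Graph → ℕ → Set
HasCliqueOfSize G b = ∃ λ S → IsClique G S × ∣ S ∣ ≡ b

hasCliqueOfSize? : ∀ G b → Dec (HasCliqueOfSize G b)
hasCliqueOfSize? G b = anySubset? (λ S → isClique? G S ×-dec ∣ S ∣ ≟ℕ b)

maximumClique : ∀ G → ∃ (IsMaxClique G)
maximumClique G
  with greatest (hasCliqueOfSize? G) (n G)
         (λ (S , _ , ∣S∣≡b) → subst (_≤ n G) ∣S∣≡b (∣p∣≤n S))
         (⊥ , (λ x _ x∈⊥ → contradiction x∈⊥ ∉⊥) , ∣⊥∣≡0 (n G))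
... | _ , (S , S-clique , refl) , S-max = S , S-clique , λ T T-clique → S-max (T , T-clique , refl)

edgeClique : ∀ G → HasEdge G → ∃ λ S → IsClique G S × 2 ≤ ∣ S ∣
edgeClique G (x , y , x~y) = ⁅ x ⁆ ∪ ⁅ y ⁆ , clique , two
  where
  x≢y : x ≢ y
  x≢y x≡y = contradiction (trans (sym x~y) (trans (cong (adj G x) (sym x≡y)) (irrefl G x))) λ ()
  ∈pair⁻ : ∀ {z} → z ∈ ⁅ x ⁆ ∪ ⁅ y ⁆ → z ≡ x ⊎ z ≡ y
  ∈pair⁻ z∈ = Sum.map (x∈⁅y⁆⇒x≡y x) (x∈⁅y⁆⇒x≡y y) (x∈p∪q⁻ ⁅ x ⁆ ⁅ y ⁆ z∈)
  clique : IsClique G (⁅ x ⁆ ∪ ⁅ y ⁆)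
  clique z w z∈ w∈ z≢w with ∈pair⁻ z∈ | ∈pair⁻ w∈
  ... | inj₁ refl | inj₁ refl = contradiction refl z≢w
  ... | inj₁ refl | inj₂ refl = x~y
  ... | inj₂ refl | inj₁ refl = trans (Graph.sym G y x) x~y
  ... | inj₂ refl | inj₂ refl = contradiction refl z≢w
  two : 2 ≤ ∣ ⁅ x ⁆ ∪ ⁅ y ⁆ ∣
  two = subst (_< ∣ ⁅ x ⁆ ∪ ⁅ y ⁆ ∣) (∣⁅x⁆∣≡1 x)
    (p⊂q⇒∣p∣<∣q∣ (p⊆p∪q ⁅ y ⁆ , y , x∈p∪q⁺ (inj₂ (x∈⁅x⁆ y)) , x≢y ∘ sym ∘ x∈⁅y⁆⇒x≡y x))

module _ {k} {𝒢 : Graph → Set} (hereditary : Hereditary 𝒢)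
         (simplicial : ∀ G → 𝒢 G → 1 ≤ n G → ∃[ v ] KSimplicial k G v) where

  -- Recursion on the order m: Agda does not see G - v as structurally smaller than G.
  colouringOfOrder : ∀ m G → n G ≡ m → 𝒢 G → ∀ {b} → 2 ≤ b → CliquesAtMost G b →
    ∃ λ (p : Fin (n G) → Fin (suc k)) → MonochromaticCliquesBelow G p b
  colouringOfOrder zero _ refl _ 2≤b _ = (λ ()) , λ { [] _ _ _ → ≤-trans (s≤s z≤n) 2≤b }
  colouringOfOrder (suc m) G@record { adj = a ; sym = a-sym ; irrefl = a-irrefl } refl G∈𝒢 2≤b ω≤
    with simplicial G G∈𝒢 (s≤s z≤n)
  ... | v , v-simplicial =
    extendColouring v-simplicial 2≤b ω≤ (colouringOfOrder m G-v refl G-v∈𝒢 2≤b (cliquesAtMost-G-v ω≤))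
    where
    open Deletion a a-sym a-irrefl v using (G-v; cliquesAtMost-G-v; extendColouring)
    G-v∈𝒢 : 𝒢 G-v
    G-v∈𝒢 = hereditary G G-v G∈𝒢 (induced-isInducedSubgraph G (punchIn v) (punchIn-injective v _ _))

  goodPartition : ∀ H → 𝒢 H → HasEdge H → GoodPartition (suc k) H
  goodPartition H H∈𝒢 edge with maximumClique H | edgeClique H edge
  ... | S₀ , S₀-clique , S₀-max | E , E-clique , 2≤∣E∣
    with colouringOfOrder (n H) H refl H∈𝒢 (≤-trans 2≤∣E∣ (S₀-max E E-clique)) S₀-max
  ... | p , p-good =
    p , λ S (S-clique , S-max) i S-mono → <⇒≱ (p-good S i S-clique S-mono) (S-max S₀ S₀-clique)

-- The argument works for every k.
theorem1p5 : (k : ℕ) → 2 ≤ k → (𝒢 : Graph → Set) → Hereditary 𝒢 →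
    (∀ G → 𝒢 G → 1 ≤ n G → ∃[ v ] KSimplicial k G v) →
    ∀ G → 𝒢 G → HasEdge G → Divisible (k + 1) G
theorem1p5 k _ 𝒢 hereditary simplicial G G∈𝒢 edge rewrite +-comm k 1 =
  edge , λ H H⊆G → goodPartition hereditary simplicial H (hereditary G H G∈𝒢 H⊆G)
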